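{- For every integer $n \ge 3$ we have $g_3(n) = 1$.
   Context: For positive integers $n$ and $k \ge 3$, $g_k(n)$ denotes the smallest integer such that for every set $A \subseteq \{1, 2, \ldots, 2n\}$ with $|A| \ge n + g_k(n)$ there exist pairwise distinct integers $b_1, \ldots, b_k$ (arbitrary integers, not required to be positive or to lie in $A$) with $b_i + b_j \in A$ for all $1 \le i < j \le k$. -}

module Defs where

open import Data.Nat using (ℕ; suc; _*_)
open import Data.Integer using (ℤ; +_; _+_; _≤_)
open import Data.Fin using (Fin; toℕ; _<_)
open import Data.Fin.Subset using (Subset; _∈_; ∣_∣)
open import Data.Product using (Σ; _×_)
open import Relation.Binary.PropositionalEquality using (_≡_; _≢_)

-- A subset of {1, …, 2n} is a Subset (2 * n); the element x : Fin (2 * n)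
-- represents the integer  toℕ x + 1.
SetOf : ℕ → Set
SetOf n = Subset (2 * n)

_∈ᴬ_ : {n : ℕ} → ℤ → SetOf n → Set
_∈ᴬ_ {n} z A = Σ (Fin (2 * n)) λ x → (x ∈ A) × (z ≡ + suc (toℕ x))

HasSumClique : (k n : ℕ) → SetOf n → Set
HasSumClique k n A =
  Σ (Fin k → ℤ) λ b →
    (∀ (i j : Fin k) → i ≢ j → b i ≢ b j) ×
    (∀ (i j : Fin k) → i < j → _∈ᴬ_ {n} (b i + b j) A)

Threshold : (k n : ℕ) → ℤ → Set
Threshold k n g = ∀ (A : SetOf n) → (+ n + g) ≤ + ∣ A ∣ → HasSumClique k n A

IsGk : (k n : ℕ) → ℤ → Set
IsGk k n g = Threshold k n g × (∀ (h : ℤ) → Threshold k n h → g ≤ h)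

-- Three distinct numbers p, q, r with p + q + r = 2s are the pairwise sums of s − r, s − q and s − p.
-- At most n of the numbers 1, …, 2n are odd, so a set of n + 1 of them contains two odd numbers and
-- an even one, or (having at most one odd number) n ≥ 3 even ones: three elements with even sum.
-- Conversely the n odd numbers of {1, …, 2n} are not enough, as
-- (b₁ + b₂) + (b₁ + b₃) + (b₂ + b₃) = 2 (b₁ + b₂ + b₃) cannot be a sum of three odd numbers.
module Submission where

open import Defs
open import Data.Nat using (ℕ; _≤_)
open import Data.Integer using (+_)

open import Data.Nat as ℕ using (zero; suc; z≤n; s≤s; _*_; _≤?_; ⌈_/2⌉)
import Data.Nat.Properties as ℕ
open import Data.Integer as ℤ using (ℤ; -[1+_]; _+_; 0ℤ)
import Data.Integer.Properties as ℤ
open import Data.Integer.Tactic.RingSolver using (solve-∀)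
open import Data.Fin as Fin using (Fin; toℕ)
open import Data.Fin.Properties using (toℕ-injective)
open import Data.Fin.Subset
  using (Subset; inside; outside; _∈_; _∉_; ∣_∣; _∩_; _─_; _-_; ⁅_⁆; Nonempty)
open import Data.Fin.Subset.Properties
  using (nonempty?; Empty-unique; ∣⊥∣≡0; ∣p∩q∣≤∣q∣; ∣⁅x⁆∣≡1; x∈⁅x⁆; p─q⊆p; x∈p∩q⁻)
open import Data.Vec using ([]; _∷_; here; there)
open import Data.Product using (_×_; _,_; proj₁; proj₂; ∃-syntax)
open import Function using (_∘_)
open import Relation.Nullary using (¬_; Dec; yes; no; contradiction)
open import Relation.Binary.PropositionalEquality

private variable
  m k : ℕ

∣p∩q∣+∣p─q∣≡∣p∣ : ∀ (p q : Subset m) → ∣ p ∩ q ∣ ℕ.+ ∣ p ─ q ∣ ≡ ∣ p ∣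
∣p∩q∣+∣p─q∣≡∣p∣ []            []            = refl
∣p∩q∣+∣p─q∣≡∣p∣ (inside  ∷ p) (inside  ∷ q) = cong suc (∣p∩q∣+∣p─q∣≡∣p∣ p q)
∣p∩q∣+∣p─q∣≡∣p∣ (inside  ∷ p) (outside ∷ q) =
  trans (ℕ.+-suc ∣ p ∩ q ∣ ∣ p ─ q ∣) (cong suc (∣p∩q∣+∣p─q∣≡∣p∣ p q))
∣p∩q∣+∣p─q∣≡∣p∣ (outside ∷ p) (inside  ∷ q) = ∣p∩q∣+∣p─q∣≡∣p∣ p q
∣p∩q∣+∣p─q∣≡∣p∣ (outside ∷ p) (outside ∷ q) = ∣p∩q∣+∣p─q∣≡∣p∣ p q

x∈p─q⇒x∉q : ∀ (p q : Subset m) {x} → x ∈ p ─ q → x ∉ q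
x∈p─q⇒x∉q (_ ∷ p) (_      ∷ q) (there x∈p─q) (there x∈q) = x∈p─q⇒x∉q p q x∈p─q x∈q
x∈p─q⇒x∉q (_ ∷ _) (inside ∷ _) ()            here

x∈p-y⇒x≢y : ∀ {p : Subset m} {x y} → x ∈ p - y → x ≢ y
x∈p-y⇒x≢y {p = p} {y = y} x∈p-y refl = x∈p─q⇒x∉q p ⁅ y ⁆ x∈p-y (x∈⁅x⁆ y)

1≤∣p∣⇒Nonempty : ∀ {p : Subset m} → 1 ≤ ∣ p ∣ → Nonempty p
1≤∣p∣⇒Nonempty {m} {p} 1≤∣p∣ with nonempty? p
... | yes p-nonempty = p-nonempty
... | no  p-empty    = contradiction (subst (1 ≤_) (∣⊥∣≡0 m) 1≤∣⊥∣) λ ()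
  where 1≤∣⊥∣ = subst (λ q → 1 ≤ ∣ q ∣) (Empty-unique p-empty) 1≤∣p∣

∃-∈-removing : ∀ {p : Subset m} → suc k ≤ ∣ p ∣ → ∃[ x ] x ∈ p × k ≤ ∣ p - x ∣
∃-∈-removing {k = k} {p = p} 1+k≤∣p∣ with 1≤∣p∣⇒Nonempty (ℕ.≤-trans (s≤s z≤n) 1+k≤∣p∣)
... | x , x∈p = x , x∈p , ℕ.+-cancelˡ-≤ 1 k ∣ p - x ∣ (begin
  1 ℕ.+ k                         ≤⟨ 1+k≤∣p∣ ⟩
  ∣ p ∣                           ≡⟨ ∣p∩q∣+∣p─q∣≡∣p∣ p ⁅ x ⁆ ⟨
  ∣ p ∩ ⁅ x ⁆ ∣ ℕ.+ ∣ p - x ∣     ≤⟨ ℕ.+-monoˡ-≤ ∣ p - x ∣ (∣p∩q∣≤∣q∣ p ⁅ x ⁆) ⟩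
  ∣ ⁅ x ⁆ ∣ ℕ.+ ∣ p - x ∣         ≡⟨ cong (ℕ._+ ∣ p - x ∣) (∣⁅x⁆∣≡1 x) ⟩
  1 ℕ.+ ∣ p - x ∣                 ∎)
  where open ℕ.≤-Reasoning

-- Position x represents toℕ x + 1, so odds m holds the positions of the odd numbers in {1, …, m}.
odds : ∀ m → Subset m
odds zero          = []
odds (suc zero)    = inside ∷ []
odds (suc (suc m)) = inside ∷ outside ∷ odds m

∣odds∣≡⌈m/2⌉ : ∀ m → ∣ odds m ∣ ≡ ⌈ m /2⌉
∣odds∣≡⌈m/2⌉ zero          = refl
∣odds∣≡⌈m/2⌉ (suc zero)    = refl
∣odds∣≡⌈m/2⌉ (suc (suc m)) = cong suc (∣odds∣≡⌈m/2⌉ m)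

∣odds[2n]∣≡n : ∀ n → ∣ odds (2 * n) ∣ ≡ n
∣odds[2n]∣≡n n = begin
  ∣ odds (2 * n) ∣     ≡⟨ ∣odds∣≡⌈m/2⌉ (2 * n) ⟩
  ⌈ 2 * n /2⌉          ≡⟨ cong (λ j → ⌈ n ℕ.+ j /2⌉) (ℕ.+-identityʳ n) ⟩
  ⌈ n ℕ.+ n /2⌉        ≡⟨ ℕ.n≡⌈n+n/2⌉ n ⟨
  n                    ∎
  where open ≡-Reasoning

x∈odds⇒toℕ-even : ∀ {x : Fin m} → x ∈ odds m → ∃[ a ] toℕ x ≡ a ℕ.+ a
x∈odds⇒toℕ-even {suc zero}    {Fin.zero}            here               = 0 , refl
x∈odds⇒toℕ-even {suc (suc m)} {Fin.zero}            here               = 0 , refl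
x∈odds⇒toℕ-even {suc (suc m)} {Fin.suc (Fin.suc x)} (there (there x∈)) with x∈odds⇒toℕ-even x∈
... | a , toℕx≡a+a = suc a , cong suc (trans (cong suc toℕx≡a+a) (sym (ℕ.+-suc a a)))

x∉odds⇒toℕ-odd : ∀ {x : Fin m} → x ∉ odds m → ∃[ a ] toℕ x ≡ suc (a ℕ.+ a)
x∉odds⇒toℕ-odd {suc zero}    {Fin.zero}            x∉ = contradiction here x∉
x∉odds⇒toℕ-odd {suc (suc m)} {Fin.zero}            x∉ = contradiction here x∉
x∉odds⇒toℕ-odd {suc (suc m)} {Fin.suc Fin.zero}    x∉ = 0 , refl
x∉odds⇒toℕ-odd {suc (suc m)} {Fin.suc (Fin.suc x)} x∉ with x∉odds⇒toℕ-odd (x∉ ∘ there ∘ there)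
... | a , toℕx≡1+a+a = suc a , cong (suc ∘ suc) (trans toℕx≡1+a+a (sym (ℕ.+-suc a a)))

double≢1 : ∀ (u : ℤ) → u + u ≢ + 1
double≢1 (+ zero)  ()
double≢1 (+ suc j) 2j+2≡1 =
  ℕ.1+n≢0 (trans (sym (ℕ.+-suc j j)) (ℕ.suc-injective (ℤ.+-injective 2j+2≡1)))
double≢1 -[1+ j ]  ()

double≢1+double : ∀ (u v : ℤ) → u + u ≢ + 1 + (v + v)
double≢1+double u v u+u≡1+v+v = double≢1 (u ℤ.- v) (begin
  (u ℤ.- v) + (u ℤ.- v)          ≡⟨ regroup u v ⟩
  (u + u) ℤ.- (v + v)            ≡⟨ cong (ℤ._- (v + v)) u+u≡1+v+v ⟩
  + 1 + (v + v) ℤ.- (v + v)      ≡⟨ cancel (v + v) ⟩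
  + 1                            ∎)
  where
  open ≡-Reasoning
  regroup : ∀ u v → (u ℤ.- v) + (u ℤ.- v) ≡ (u + u) ℤ.- (v + v)
  regroup = solve-∀
  cancel : ∀ w → + 1 + w ℤ.- w ≡ + 1
  cancel = solve-∀

complement-sum : ∀ {u v w s : ℤ} → u + v + w ≡ s + s → (s ℤ.- w) + (s ℤ.- v) ≡ u
complement-sum {u} {v} {w} {s} u+v+w≡s+s = begin
  (s ℤ.- w) + (s ℤ.- v)              ≡⟨ regroup u v w s ⟩
  u + ((s + s) ℤ.- (u + v + w))      ≡⟨ cong (λ t → u + ((s + s) ℤ.- t)) u+v+w≡s+s ⟩
  u + ((s + s) ℤ.- (s + s))          ≡⟨ cong (λ t → u + t) (ℤ.+-inverseʳ (s + s)) ⟩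
  u + 0ℤ                             ≡⟨ ℤ.+-identityʳ u ⟩
  u                                  ∎
  where
  open ≡-Reasoning
  regroup : ∀ u v w s → (s ℤ.- w) + (s ℤ.- v) ≡ u + ((s + s) ℤ.- (u + v + w))
  regroup = solve-∀

triangle⇒HasSumClique : ∀ {n} (A : SetOf n) (b₀ b₁ b₂ : ℤ) →
  _∈ᴬ_ {n} (b₀ + b₁) A → _∈ᴬ_ {n} (b₀ + b₂) A → _∈ᴬ_ {n} (b₁ + b₂) A →
  b₀ + b₁ ≢ b₀ + b₂ → b₀ + b₁ ≢ b₁ + b₂ → b₀ + b₂ ≢ b₁ + b₂ →
  HasSumClique 3 n A
triangle⇒HasSumClique {n} A b₀ b₁ b₂ b₀₁∈A b₀₂∈A b₁₂∈A b₀₁≢b₀₂ b₀₁≢b₁₂ b₀₂≢b₁₂ = b , distinct , sums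
  where
  b : Fin 3 → ℤ
  b Fin.zero                      = b₀
  b (Fin.suc Fin.zero)            = b₁
  b (Fin.suc (Fin.suc Fin.zero))  = b₂

  b₀≢b₁ : b₀ ≢ b₁
  b₀≢b₁ b₀≡b₁ = b₀₂≢b₁₂ (cong (_+ b₂) b₀≡b₁)
  b₀≢b₂ : b₀ ≢ b₂
  b₀≢b₂ b₀≡b₂ = b₀₁≢b₁₂ (trans (cong (_+ b₁) b₀≡b₂) (ℤ.+-comm b₂ b₁))
  b₁≢b₂ : b₁ ≢ b₂
  b₁≢b₂ b₁≡b₂ = b₀₁≢b₀₂ (cong (λ t → b₀ + t) b₁≡b₂)

  distinct : ∀ i j → i ≢ j → b i ≢ b j
  distinct Fin.zero                     Fin.zero                     i≢i = contradiction refl i≢i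
  distinct Fin.zero                     (Fin.suc Fin.zero)           _   = b₀≢b₁
  distinct Fin.zero                     (Fin.suc (Fin.suc Fin.zero)) _   = b₀≢b₂
  distinct (Fin.suc Fin.zero)           Fin.zero                     _   = b₀≢b₁ ∘ sym
  distinct (Fin.suc Fin.zero)           (Fin.suc Fin.zero)           i≢i = contradiction refl i≢i
  distinct (Fin.suc Fin.zero)           (Fin.suc (Fin.suc Fin.zero)) _   = b₁≢b₂
  distinct (Fin.suc (Fin.suc Fin.zero)) Fin.zero                     _   = b₀≢b₂ ∘ sym
  distinct (Fin.suc (Fin.suc Fin.zero)) (Fin.suc Fin.zero)           _   = b₁≢b₂ ∘ sym
  distinct (Fin.suc (Fin.suc Fin.zero)) (Fin.suc (Fin.suc Fin.zero)) i≢i = contradiction refl i≢i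

  sums : ∀ i j → i Fin.< j → _∈ᴬ_ {n} (b i + b j) A
  sums Fin.zero           (Fin.suc Fin.zero)           _ = b₀₁∈A
  sums Fin.zero           (Fin.suc (Fin.suc Fin.zero)) _ = b₀₂∈A
  sums (Fin.suc Fin.zero) (Fin.suc (Fin.suc Fin.zero)) _ = b₁₂∈A
  sums Fin.zero                     Fin.zero                     ()
  sums (Fin.suc Fin.zero)           Fin.zero                     ()
  sums (Fin.suc Fin.zero)           (Fin.suc Fin.zero)           (s≤s ())
  sums (Fin.suc (Fin.suc Fin.zero)) Fin.zero                     ()
  sums (Fin.suc (Fin.suc Fin.zero)) (Fin.suc Fin.zero)           (s≤s ())
  sums (Fin.suc (Fin.suc Fin.zero)) (Fin.suc (Fin.suc Fin.zero)) (s≤s (s≤s ()))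

value : Fin m → ℤ
value x = + suc (toℕ x)

value-injective : ∀ {x y : Fin m} → value x ≡ value y → x ≡ y
value-injective = toℕ-injective ∘ ℕ.suc-injective ∘ ℤ.+-injective

value-sum : ∀ {x y z : Fin m} {i j k} → toℕ x ≡ i → toℕ y ≡ j → toℕ z ≡ k →
  value x + value y + value z ≡ + (suc i ℕ.+ suc j ℕ.+ suc k)
value-sum refl refl refl = refl

two-odds-one-even⇒sum-even : ∀ {x y z : Fin m} → x ∈ odds m → y ∈ odds m → z ∉ odds m →
  ∃[ s ] value x + value y + value z ≡ s + s
two-odds-one-even⇒sum-even x∈O y∈O z∉O
  with x∈odds⇒toℕ-even x∈O | x∈odds⇒toℕ-even y∈O | x∉odds⇒toℕ-odd z∉O
... | a , toℕx≡a+a | c , toℕy≡c+c | d , toℕz≡1+d+d =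
  + 2 + + a + + c + + d , trans (value-sum toℕx≡a+a toℕy≡c+c toℕz≡1+d+d) (sum (+ a) (+ c) (+ d))
  where
  sum : ∀ a c d → (+ 1 + (a + a)) + (+ 1 + (c + c)) + (+ 2 + (d + d))
                ≡ (+ 2 + a + c + d) + (+ 2 + a + c + d)
  sum = solve-∀

three-evens⇒sum-even : ∀ {x y z : Fin m} → x ∉ odds m → y ∉ odds m → z ∉ odds m →
  ∃[ s ] value x + value y + value z ≡ s + s
three-evens⇒sum-even x∉O y∉O z∉O
  with x∉odds⇒toℕ-odd x∉O | x∉odds⇒toℕ-odd y∉O | x∉odds⇒toℕ-odd z∉O
... | a , toℕx≡1+a+a | c , toℕy≡1+c+c | d , toℕz≡1+d+d =
  + 3 + + a + + c + + d , trans (value-sum toℕx≡1+a+a toℕy≡1+c+c toℕz≡1+d+d) (sum (+ a) (+ c) (+ d))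
  where
  sum : ∀ a c d → (+ 2 + (a + a)) + (+ 2 + (c + c)) + (+ 2 + (d + d))
                ≡ (+ 3 + a + c + d) + (+ 3 + a + c + d)
  sum = solve-∀

even-triple⇒HasSumClique : ∀ {n} (A : SetOf n) {x y z : Fin (2 * n)} →
  x ∈ A → y ∈ A → z ∈ A → x ≢ y → x ≢ z → y ≢ z →
  ∃[ s ] value x + value y + value z ≡ s + s → HasSumClique 3 n A
even-triple⇒HasSumClique {n} A {x} {y} {z} x∈A y∈A z∈A x≢y x≢z y≢z (s , xyz≡s+s) =
  triangle⇒HasSumClique {n} A (s ℤ.- value z) (s ℤ.- value y) (s ℤ.- value x)
    (x , x∈A , sum≡x) (y , y∈A , sum≡y) (z , z∈A , sum≡z)
    (λ e → x≢y (value-injective (trans (sym sum≡x) (trans e sum≡y))))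
    (λ e → x≢z (value-injective (trans (sym sum≡x) (trans e sum≡z))))
    (λ e → y≢z (value-injective (trans (sym sum≡y) (trans e sum≡z))))
  where
  X = value x
  Y = value y
  Z = value z
  sum≡x : (s ℤ.- Z) + (s ℤ.- Y) ≡ X
  sum≡x = complement-sum {X} {Y} {Z} {s} xyz≡s+s
  sum≡y : (s ℤ.- Z) + (s ℤ.- X) ≡ Y
  sum≡y = complement-sum {Y} {X} {Z} {s} (trans (cong (_+ Z) (ℤ.+-comm Y X)) xyz≡s+s)
  sum≡z : (s ℤ.- Y) + (s ℤ.- X) ≡ Z
  sum≡z = complement-sum {Z} {X} {Y} {s}
    (trans (trans (ℤ.+-assoc Z X Y) (ℤ.+-comm Z (X + Y))) xyz≡s+s)

all-odd⇒¬HasSumClique : ∀ {n} (A : SetOf n) →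
  (∀ {z} → _∈ᴬ_ {n} z A → ∃[ a ] z ≡ + suc (a ℕ.+ a)) → ¬ HasSumClique 3 n A
all-odd⇒¬HasSumClique A odd (b , _ , sums)
  with odd (sums Fin.zero (Fin.suc Fin.zero) (s≤s z≤n))
     | odd (sums Fin.zero (Fin.suc (Fin.suc Fin.zero)) (s≤s z≤n))
     | odd (sums (Fin.suc Fin.zero) (Fin.suc (Fin.suc Fin.zero)) (s≤s (s≤s z≤n)))
... | a , b₀₁≡ | c , b₀₂≡ | d , b₁₂≡ =
  double≢1+double (b₀ + b₁ + b₂) (+ 1 + + a + + c + + d) (begin
    (b₀ + b₁ + b₂) + (b₀ + b₁ + b₂)                 ≡⟨ regroup b₀ b₁ b₂ ⟩
    (b₀ + b₁) + (b₀ + b₂) + (b₁ + b₂)               ≡⟨ cong₂ _+_ (cong₂ _+_ b₀₁≡ b₀₂≡) b₁₂≡ ⟩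
    + suc (a ℕ.+ a) + + suc (c ℕ.+ c) + + suc (d ℕ.+ d) ≡⟨ three-odds (+ a) (+ c) (+ d) ⟩
    + 1 + ((+ 1 + + a + + c + + d) + (+ 1 + + a + + c + + d)) ∎)
  where
  open ≡-Reasoning
  b₀ = b Fin.zero
  b₁ = b (Fin.suc Fin.zero)
  b₂ = b (Fin.suc (Fin.suc Fin.zero))
  regroup : ∀ b₀ b₁ b₂ → (b₀ + b₁ + b₂) + (b₀ + b₁ + b₂) ≡ (b₀ + b₁) + (b₀ + b₂) + (b₁ + b₂)
  regroup = solve-∀
  three-odds : ∀ a c d → (+ 1 + (a + a)) + (+ 1 + (c + c)) + (+ 1 + (d + d))
                       ≡ + 1 + ((+ 1 + a + c + d) + (+ 1 + a + c + d))
  three-odds = solve-∀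

bounded-cancel : ∀ {j k o e} → j ℕ.+ k ≤ o ℕ.+ e → o ≤ j → k ≤ e
bounded-cancel {j} {k} {o} {e} j+k≤o+e o≤j =
  ℕ.+-cancelˡ-≤ j k e (ℕ.≤-trans j+k≤o+e (ℕ.+-monoˡ-≤ e o≤j))

module _ {n : ℕ} (A : SetOf n) where
  private
    O : Subset (2 * n)
    O = odds (2 * n)

  two-odds-one-even⇒HasSumClique : 2 ≤ ∣ A ∩ O ∣ → 1 ≤ ∣ A ─ O ∣ → HasSumClique 3 n A
  two-odds-one-even⇒HasSumClique 2≤∣A∩O∣ 1≤∣A─O∣
    with ∃-∈-removing 2≤∣A∩O∣ | ∃-∈-removing 1≤∣A─O∣
  ... | x , x∈A∩O , 1≤∣A∩O-x∣ | z , z∈A─O , _ with ∃-∈-removing 1≤∣A∩O-x∣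
  ... | y , y∈A∩O-x , _ =
    even-triple⇒HasSumClique {n} A (proj₁ x∈A×O) (proj₁ y∈A×O) (p─q⊆p A O z∈A─O)
      (x∈p-y⇒x≢y y∈A∩O-x ∘ sym) (λ { refl → z∉O (proj₂ x∈A×O) }) (λ { refl → z∉O (proj₂ y∈A×O) })
      (two-odds-one-even⇒sum-even (proj₂ x∈A×O) (proj₂ y∈A×O) z∉O)
    where
    x∈A×O : x ∈ A × x ∈ O
    x∈A×O = x∈p∩q⁻ A O x∈A∩O
    y∈A×O : y ∈ A × y ∈ O
    y∈A×O = x∈p∩q⁻ A O (p─q⊆p (A ∩ O) ⁅ x ⁆ y∈A∩O-x)
    z∉O : z ∉ O
    z∉O = x∈p─q⇒x∉q A O z∈A─O

  three-evens⇒HasSumClique : 3 ≤ ∣ A ─ O ∣ → HasSumClique 3 n A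
  three-evens⇒HasSumClique 3≤∣A─O∣ with ∃-∈-removing 3≤∣A─O∣
  ... | x , x∈A─O , 2≤∣A─O-x∣ with ∃-∈-removing 2≤∣A─O-x∣
  ... | y , y∈A─O-x , 1≤∣A─O-x-y∣ with ∃-∈-removing 1≤∣A─O-x-y∣
  ... | z , z∈A─O-x-y , _ =
    even-triple⇒HasSumClique {n} A (p─q⊆p A O x∈A─O) (p─q⊆p A O y∈A─O) (p─q⊆p A O z∈A─O)
      (x∈p-y⇒x≢y y∈A─O-x ∘ sym) (x∈p-y⇒x≢y z∈A─O-x ∘ sym) (x∈p-y⇒x≢y z∈A─O-x-y ∘ sym)
      (three-evens⇒sum-even (x∈p─q⇒x∉q A O x∈A─O) (x∈p─q⇒x∉q A O y∈A─O) (x∈p─q⇒x∉q A O z∈A─O))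
    where
    y∈A─O : y ∈ A ─ O
    y∈A─O = p─q⊆p (A ─ O) ⁅ x ⁆ y∈A─O-x
    z∈A─O-x : z ∈ (A ─ O) - x
    z∈A─O-x = p─q⊆p ((A ─ O) - x) ⁅ y ⁆ z∈A─O-x-y
    z∈A─O : z ∈ A ─ O
    z∈A─O = p─q⊆p (A ─ O) ⁅ x ⁆ z∈A─O-x

  n+1≤∣A∣⇒HasSumClique : 3 ≤ n → n ℕ.+ 1 ≤ ∣ A ∣ → HasSumClique 3 n A
  n+1≤∣A∣⇒HasSumClique 3≤n n+1≤∣A∣ = by-odd-count (2 ≤? ∣ A ∩ O ∣)
    where
    n+1≤odd+even : n ℕ.+ 1 ≤ ∣ A ∩ O ∣ ℕ.+ ∣ A ─ O ∣
    n+1≤odd+even = subst (n ℕ.+ 1 ≤_) (sym (∣p∩q∣+∣p─q∣≡∣p∣ A O)) n+1≤∣A∣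

    odd≤n : ∣ A ∩ O ∣ ≤ n
    odd≤n = ℕ.≤-trans (∣p∩q∣≤∣q∣ A O) (ℕ.≤-reflexive (∣odds[2n]∣≡n n))

    by-odd-count : Dec (2 ≤ ∣ A ∩ O ∣) → HasSumClique 3 n A
    by-odd-count (yes 2≤odd) =
      two-odds-one-even⇒HasSumClique 2≤odd (bounded-cancel n+1≤odd+even odd≤n)
    by-odd-count (no  2≰odd) = three-evens⇒HasSumClique (ℕ.≤-trans 3≤n (bounded-cancel
      (subst (_≤ ∣ A ∩ O ∣ ℕ.+ ∣ A ─ O ∣) (ℕ.+-comm n 1) n+1≤odd+even)
      (ℕ.≤-pred (ℕ.≰⇒> 2≰odd))))

Threshold-mono : ∀ {k n g h} → g ℤ.≤ h → Threshold k n g → Threshold k n h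
Threshold-mono {n = n} g≤h threshold A n+h≤∣A∣ =
  threshold A (ℤ.≤-trans (ℤ.+-monoʳ-≤ (+ n) g≤h) n+h≤∣A∣)

¬Threshold-0 : ∀ n → ¬ Threshold 3 n 0ℤ
¬Threshold-0 n threshold =
  all-odd⇒¬HasSumClique {n} (odds (2 * n)) odd-value
    (threshold (odds (2 * n)) (ℤ.+≤+ n+0≤∣odds∣))
  where
  odd-value : ∀ {z} → _∈ᴬ_ {n} z (odds (2 * n)) → ∃[ a ] z ≡ + suc (a ℕ.+ a)
  odd-value (x , x∈odds , z≡x) with x∈odds⇒toℕ-even x∈odds
  ... | a , toℕx≡a+a = a , trans z≡x (cong (+_ ∘ suc) toℕx≡a+a)

  n+0≤∣odds∣ : n ℕ.+ 0 ≤ ∣ odds (2 * n) ∣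
  n+0≤∣odds∣ = ℕ.≤-reflexive (trans (ℕ.+-identityʳ n) (sym (∣odds[2n]∣≡n n)))

theorem1 : ∀ (n : ℕ) → 3 ≤ n → IsGk 3 n (+ 1)
theorem1 n 3≤n = (λ A → n+1≤∣A∣⇒HasSumClique A 3≤n ∘ ℤ.drop‿+≤+) , least
  where
  least : ∀ h → Threshold 3 n h → + 1 ℤ.≤ h
  least (+ suc _)  _         = ℤ.+≤+ (s≤s z≤n)
  least (+ zero)   threshold = contradiction threshold (¬Threshold-0 n)
  least -[1+ _ ]   threshold =
    contradiction (Threshold-mono {n = n} ℤ.-≤+ threshold) (¬Threshold-0 n)
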